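{- Let $\mathcal{Q}=\{q_v: v\in V(\Gamma)\}$, $\Gamma$, $g$ be as in the context, and let $C$ be a circle in $\Gamma$. (1) If $C$ is central, then $C$ is balanced. (2) If $C$ is balanced and there is an edge $e$ of $C$ such that the set of vectors $\{q_v-q_u : C\setminus\{e\} \text{ has an edge from } u \text{ to } v\}$ is linearly independent, then $C$ is central. (3) If $C$ is a balanced circle with at most $d+1$ edges and the points of $\mathcal{Q}$ corresponding to the vertices of $C$ are in affine position, then $C$ is central.
   Context: Work in real Euclidean affine space of dimension $d$, identified with $\mathbb{R}^d$, with squared distance $d^2(x,y)=|x-y|^2$. An additive real gain graph $(\Gamma,g)$ is a finite graph $\Gamma$ (no loops, parallel edges allowed) with a function $g$ from oriented edges to $\mathbb{R}$ satisfying $g(\bar e)=-g(e)$ for the reversed edge $\bar e$. A circle $C$ (traversed as a closed walk with edges $e_1,\dots,e_k$ oriented coherently along it) is balanced if $\sum_{i=1}^k g(e_i)=0$. $\mathcal{Q}=\{q_v: v\in V(\Gamma)\}$ is a set of distinct points ("reference points") in $\mathbb{R}^d$ indexed by the vertices. For an edge $e$ oriented from $u$ to $v$, its hyperplane is $h_e=\{x\in\mathbb{R}^d: d^2(x,q_u)-d^2(x,q_v)=g(e)\}$ (independent of the orientation chosen, by $g(\bar e)=-g(e)$). The Pythagorean arrangement is $\{h_e: e\in E(\Gamma)\}$. An edge set $S$ is central if $\bigcap_{e\in S}h_e\neq\emptyset$. A set of points is in affine position if every subset of $n$ of them with $0\le n\le d+1$ spans an affine flat of dimension $n-1$. -}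

module Defs where

open import Level using (0ℓ)
open import Data.Nat as ℕ using (ℕ; zero; suc)
open import Data.Fin as Fin using (Fin; zero; suc; toℕ; fromℕ<; punchIn)
open import Data.Bool using (Bool; true; false; if_then_else_)
open import Data.Product using (Σ; ∃; _×_; _,_; proj₁; proj₂)
open import Data.Sum using (_⊎_)
open import Relation.Nullary using (¬_; yes; no)
open import Relation.Binary.PropositionalEquality using (_≡_; _≢_)
open import Relation.Binary.Structures using (IsStrictTotalOrder)
open import Algebra.Structures using (IsCommutativeRing)
open import Function.Definitions using (Injective)

-- The real numbers, axiomatised as a complete ordered field.
-- (Any two models are isomorphic, so quantifying over all models
-- is the same as speaking about ℝ.)

record RealField : Set₁ where
  infixl 6 _+_
  infixl 7 _*_
  field
    R   : Set
    _+_ _*_ : R → R → R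
    -_  : R → R
    0# 1# : R
    _<_ : R → R → Set
    isCommutativeRing  : IsCommutativeRing _≡_ _+_ _*_ -_ 0# 1#
    0≢1                : 0# ≢ 1#
    inverse            : ∀ x → x ≢ 0# → ∃ λ y → x * y ≡ 1#
    isStrictTotalOrder : IsStrictTotalOrder _≡_ _<_
    +-mono-<           : ∀ {x y} z → x < y → (x + z) < (y + z)
    *-pos              : ∀ {x y} → 0# < x → 0# < y → 0# < (x * y)
    -- least upper bound property (x ≤ y written as x < y ⊎ x ≡ y)
    complete : ∀ (P : R → Set) → ∃ P →
               (∃ λ b → ∀ x → P x → (x < b ⊎ x ≡ b)) →
               ∃ λ s → (∀ x → P x → (x < s ⊎ x ≡ s))
                     × (∀ b → (∀ x → P x → (x < b ⊎ x ≡ b)) → (s < b ⊎ s ≡ b))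

  _-_ : R → R → R
  x - y = x + (- y)

  sumF : ∀ {k} → (Fin k → R) → R
  sumF {zero}  f = 0#
  sumF {suc k} f = f zero + sumF (λ i → f (suc i))

  Pt : ℕ → Set
  Pt d = Fin d → R

  _−ᵥ_ : ∀ {d} → Pt d → Pt d → Pt d
  (x −ᵥ y) t = x t - y t

  dist² : ∀ {d} → Pt d → Pt d → R
  dist² x y = sumF (λ t → (x t - y t) * (x t - y t))

  LinIndep : ∀ {d k} → (Fin k → Pt d) → Set
  LinIndep {d} {k} w =
    ∀ (c : Fin k → R) → (∀ t → sumF (λ l → c l * w l t) ≡ 0#) → ∀ l → c l ≡ 0#

  AffIndep : ∀ {d n} → (Fin n → Pt d) → Set
  AffIndep {d} {n} p =
    ∀ (c : Fin n → R) → sumF c ≡ 0# →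
      (∀ t → sumF (λ l → c l * p l t) ≡ 0#) → ∀ l → c l ≡ 0#

  -- affine position: every subset of n ≤ d+1 of the points spans an
  -- affine flat of dimension n-1 (subsets given by injections)
  AffinePosition : ∀ {d N} → (Fin N → Pt d) → Set
  AffinePosition {d} {N} p =
    ∀ n (s : Fin n → Fin N) → Injective _≡_ _≡_ s → n ℕ.≤ suc d → AffIndep (λ l → p (s l))

-- Gain graphs (vertices Fin n, edges Fin m, parallel edges allowed)

record Graph (n m : ℕ) : Set where
  field
    src tgt : Fin m → Fin n
    noLoop  : ∀ e → src e ≢ tgt e

-- a dart = an edge with a traversal direction (true = src → tgt)
Dart : ℕ → Set
Dart m = Fin m × Bool

module _ {n m} (Γ : Graph n m) where
  open Graph Γ

  tail head : Dart m → Fin n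
  tail (e , b) = if b then src e else tgt e
  head (e , b) = if b then tgt e else src e

next : ∀ {k} → Fin (suc k) → Fin (suc k)
next {k} i with suc (toℕ i) ℕ.<? suc k
... | yes p = fromℕ< p
... | no _  = zero

record Circle {n m} (Γ : Graph n m) : Set where
  field
    len   : ℕ                         -- number of edges is suc len
    darts : Fin (suc len) → Dart m
    closed      : ∀ i → head Γ (darts i) ≡ tail Γ (darts (next i))
    edgesDistinct : Injective _≡_ _≡_ (λ i → proj₁ (darts i))
    vertsDistinct : Injective _≡_ _≡_ (λ i → tail Γ (darts i))

module GainGraph (ℝ : RealField) {n m} (Γ : Graph n m) where
  open RealField ℝ
  open Graph Γ

  -- gain of a dart, given gains g of edges oriented src → tgt
  -- (g(ē) = -g(e))
  dartGain : (Fin m → R) → Dart m → R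
  dartGain g (e , true)  = g e
  dartGain g (e , false) = - g e

  Balanced : (Fin m → R) → Circle Γ → Set
  Balanced g C = sumF (λ i → dartGain g (Circle.darts C i)) ≡ 0#

  -- hyperplane h_e (edge oriented src e → tgt e)
  _∈h[_,_,_] : ∀ {d} → Pt d → (Fin n → Pt d) → (Fin m → R) → Fin m → Set
  x ∈h[ q , g , e ] = dist² x (q (src e)) - dist² x (q (tgt e)) ≡ g e

  Central : ∀ {d} → (Fin n → Pt d) → (Fin m → R) → Circle Γ → Set
  Central {d} q g C =
    ∃ λ (x : Pt d) → ∀ i → x ∈h[ q , g , proj₁ (Circle.darts C i) ]

module Submission where

open import Defs
open import Data.Nat using (ℕ; suc; _≤_)
open import Data.Fin using (Fin; punchIn)
open import Data.Product using (_×_; ∃)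
open import Function.Definitions using (Injective)
open import Relation.Binary.PropositionalEquality using (_≡_)

open import Data.Nat as ℕ using (zero)
open import Data.Fin as Fin using (zero; suc; inject₁; fromℕ; toℕ)
open import Data.Fin.Properties as Finₚ using (toℕ-injective; punchIn-punchOut; ¬∀⟶∃¬; all?)
open import Data.Vec.Functional as Vec using (_∷_; insertAt)
open import Data.Vec.Functional.Properties using (insertAt-lookup; insertAt-punchIn)
open import Data.Integer as ℤ using (ℤ; -[1+_]; _⊖_)
import Data.Integer.Properties as ℤₚ
import Data.Nat.Properties as ℕₚ
open import Data.Sign as Sign using (Sign)
open import Data.Maybe using (Maybe; nothing; just)
open import Data.Product using (_,_; proj₁; proj₂)
open import Data.Sum using (_⊎_; inj₁; inj₂)
open import Data.Empty using (⊥-elim)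
open import Data.Bool using (true; false)
open import Relation.Nullary using (¬_; yes; no)
open import Relation.Binary.PropositionalEquality
  using (refl; sym; trans; cong; cong₂; subst; subst₂; _≢_; module ≡-Reasoning)
open import Relation.Binary.Structures using (IsStrictTotalOrder)
open import Relation.Binary.Definitions using (tri<; tri≈; tri>)
open import Algebra.Bundles using (CommutativeRing)
open import Algebra.Solver.Ring.AlmostCommutativeRing
  using (_-Raw-AlmostCommutative⟶_; fromCommutativeRing)

-- For any point x, the values |x - q_v|² form a potential on the vertices whose differences
-- along the edges of C telescope, so a point on all hyperplanes of C forces the gain of C
-- to vanish. Conversely |x - a|² - |x - b|² = ⟨2x, b - a⟩ + |a|² - |b|² is affine in x, so
-- centrality of C is a linear system in x with one equation per edge. Since the left-hand
-- sides also sum to zero around C, on a balanced circle any one equation follows from the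
-- others. In case (2) the remaining equations have linearly independent coefficient
-- vectors; in case (3) the system is equivalent to prescribing
-- |x - q_{v_0}|² - |x - q_{v_i}|² as the prefix sums of the gains, whose coefficient
-- vectors q_{v_i} - q_{v_0} are linearly independent by affine position.

-- The ring solver needs coefficients whose equality computes; ℤ maps into every commutative ring.

module IntegerCoefficients {c ℓ} (R : CommutativeRing c ℓ) where

  open CommutativeRing R renaming (refl to ≈-refl; sym to ≈-sym; trans to ≈-trans)
  open import Algebra.Properties.Ring ring
    using (-0#≈0#; -‿involutive; -‿distribʳ-*; -‿+-comm; -1*x≈-x)
  open import Algebra.Properties.Semiring.Mult.TCOptimised semiring
    using (×-homo-+; ×1-homo-*; 1+×) renaming (_×_ to _×ₙ_)
  open import Relation.Binary.Reasoning.Setoid setoid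

  ⟦_⟧ₙ : ℕ → Carrier
  ⟦ n ⟧ₙ = n ×ₙ 1#

  ⟦_⟧ : ℤ → Carrier
  ⟦ ℤ.+ n ⟧    = ⟦ n ⟧ₙ
  ⟦ -[1+ n ] ⟧ = - ⟦ suc n ⟧ₙ

  ⟦_⟧ₛ : Sign → Carrier
  ⟦ Sign.+ ⟧ₛ = 1#
  ⟦ Sign.- ⟧ₛ = - 1#

  private
    x-0#≈x : ∀ x → x - 0# ≈ x
    x-0#≈x x = ≈-trans (+-congˡ -0#≈0#) (+-identityʳ x)

    1+x-[1+y]≈x-y : ∀ x y → (1# + x) - (1# + y) ≈ x - y
    1+x-[1+y]≈x-y x y = begin
      (1# + x) + - (1# + y)      ≈⟨ +-congˡ (≈-sym (-‿+-comm 1# y)) ⟩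
      (1# + x) + (- 1# + - y)    ≈⟨ +-congʳ (+-comm 1# x) ⟩
      (x + 1#) + (- 1# + - y)    ≈⟨ +-assoc x 1# _ ⟩
      x + (1# + (- 1# + - y))    ≈⟨ +-congˡ (≈-sym (+-assoc 1# (- 1#) (- y))) ⟩
      x + ((1# + - 1#) + - y)    ≈⟨ +-congˡ (+-congʳ (-‿inverseʳ 1#)) ⟩
      x + (0# + - y)             ≈⟨ +-congˡ (+-identityˡ (- y)) ⟩
      x - y                      ∎

    interchange : ∀ w x y z → (w * x) * (y * z) ≈ (w * y) * (x * z)
    interchange w x y z = begin
      (w * x) * (y * z) ≈⟨ *-assoc w x _ ⟩
      w * (x * (y * z)) ≈⟨ *-congˡ (≈-sym (*-assoc x y z)) ⟩
      w * ((x * y) * z) ≈⟨ *-congˡ (*-congʳ (*-comm x y)) ⟩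
      w * ((y * x) * z) ≈⟨ *-congˡ (*-assoc y x z) ⟩
      w * (y * (x * z)) ≈⟨ ≈-sym (*-assoc w y _) ⟩
      (w * y) * (x * z) ∎

  ⟦⟧-⊖ : ∀ m n → ⟦ m ⊖ n ⟧ ≈ ⟦ m ⟧ₙ - ⟦ n ⟧ₙ
  ⟦⟧-⊖ zero    zero    = ≈-sym (x-0#≈x 0#)
  ⟦⟧-⊖ (suc m) zero    = ≈-sym (x-0#≈x _)
  ⟦⟧-⊖ zero    (suc n) = ≈-sym (+-identityˡ _)
  ⟦⟧-⊖ (suc m) (suc n) = begin
    ⟦ suc m ⊖ suc n ⟧                ≡⟨ cong ⟦_⟧ (ℤₚ.[1+m]⊖[1+n]≡m⊖n m n) ⟩
    ⟦ m ⊖ n ⟧                        ≈⟨ ⟦⟧-⊖ m n ⟩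
    ⟦ m ⟧ₙ - ⟦ n ⟧ₙ                   ≈⟨ ≈-sym (1+x-[1+y]≈x-y _ _) ⟩
    (1# + ⟦ m ⟧ₙ) - (1# + ⟦ n ⟧ₙ)     ≈⟨ ≈-sym (+-cong (1+× m 1#) (-‿cong (1+× n 1#))) ⟩
    ⟦ suc m ⟧ₙ - ⟦ suc n ⟧ₙ           ∎

  ⟦⟧-+ : ∀ i j → ⟦ i ℤ.+ j ⟧ ≈ ⟦ i ⟧ + ⟦ j ⟧
  ⟦⟧-+ (ℤ.+ m)  (ℤ.+ n)  = ×-homo-+ 1# m n
  ⟦⟧-+ (ℤ.+ m)  -[1+ n ] = ⟦⟧-⊖ m (suc n)
  ⟦⟧-+ -[1+ m ] (ℤ.+ n)  = ≈-trans (⟦⟧-⊖ n (suc m)) (+-comm _ _)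
  ⟦⟧-+ -[1+ m ] -[1+ n ] = begin
    - ⟦ suc (suc (m ℕ.+ n)) ⟧ₙ        ≡⟨ cong (λ k → - ⟦ suc k ⟧ₙ) (ℕₚ.+-suc m n) ⟨
    - ⟦ suc m ℕ.+ suc n ⟧ₙ            ≈⟨ -‿cong (×-homo-+ 1# (suc m) (suc n)) ⟩
    - (⟦ suc m ⟧ₙ + ⟦ suc n ⟧ₙ)       ≈⟨ -‿+-comm _ _ ⟨
    - ⟦ suc m ⟧ₙ + - ⟦ suc n ⟧ₙ       ∎

  ⟦⟧-◃ : ∀ s n → ⟦ s ℤ.◃ n ⟧ ≈ ⟦ s ⟧ₛ * ⟦ n ⟧ₙ
  ⟦⟧-◃ s      zero    = ≈-sym (zeroʳ ⟦ s ⟧ₛ)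
  ⟦⟧-◃ Sign.+ (suc n) = ≈-sym (*-identityˡ _)
  ⟦⟧-◃ Sign.- (suc n) = ≈-sym (-1*x≈-x _)

  ⟦⟧-sign-abs : ∀ i → ⟦ i ⟧ ≈ ⟦ ℤ.sign i ⟧ₛ * ⟦ ℤ.∣ i ∣ ⟧ₙ
  ⟦⟧-sign-abs (ℤ.+ n)  = ≈-sym (*-identityˡ _)
  ⟦⟧-sign-abs -[1+ n ] = ≈-sym (-1*x≈-x _)

  ⟦⟧ₛ-* : ∀ s t → ⟦ s Sign.* t ⟧ₛ ≈ ⟦ s ⟧ₛ * ⟦ t ⟧ₛ
  ⟦⟧ₛ-* Sign.+ t      = ≈-sym (*-identityˡ _)
  ⟦⟧ₛ-* Sign.- Sign.+ = ≈-sym (*-identityʳ _)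
  ⟦⟧ₛ-* Sign.- Sign.- = begin
    1#             ≈⟨ -‿involutive 1# ⟨
    - - 1#         ≈⟨ -‿cong (-1*x≈-x 1#) ⟨
    - (- 1# * 1#)  ≈⟨ -‿distribʳ-* (- 1#) 1# ⟩
    - 1# * - 1#    ∎

  ⟦⟧-* : ∀ i j → ⟦ i ℤ.* j ⟧ ≈ ⟦ i ⟧ * ⟦ j ⟧
  ⟦⟧-* i j = begin
    ⟦ i ℤ.* j ⟧
      ≈⟨ ⟦⟧-◃ (ℤ.sign i Sign.* ℤ.sign j) (ℤ.∣ i ∣ ℕ.* ℤ.∣ j ∣) ⟩
    ⟦ ℤ.sign i Sign.* ℤ.sign j ⟧ₛ * ⟦ ℤ.∣ i ∣ ℕ.* ℤ.∣ j ∣ ⟧ₙ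
      ≈⟨ *-cong (⟦⟧ₛ-* (ℤ.sign i) (ℤ.sign j)) (×1-homo-* ℤ.∣ i ∣ ℤ.∣ j ∣) ⟩
    (⟦ ℤ.sign i ⟧ₛ * ⟦ ℤ.sign j ⟧ₛ) * (⟦ ℤ.∣ i ∣ ⟧ₙ * ⟦ ℤ.∣ j ∣ ⟧ₙ)
      ≈⟨ interchange _ _ _ _ ⟩
    (⟦ ℤ.sign i ⟧ₛ * ⟦ ℤ.∣ i ∣ ⟧ₙ) * (⟦ ℤ.sign j ⟧ₛ * ⟦ ℤ.∣ j ∣ ⟧ₙ)
      ≈⟨ *-cong (⟦⟧-sign-abs i) (⟦⟧-sign-abs j) ⟨
    ⟦ i ⟧ * ⟦ j ⟧
      ∎

  ⟦⟧-neg : ∀ i → ⟦ ℤ.- i ⟧ ≈ - ⟦ i ⟧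
  ⟦⟧-neg (ℤ.+ zero)  = ≈-sym -0#≈0#
  ⟦⟧-neg (ℤ.+ suc n) = ≈-refl
  ⟦⟧-neg -[1+ n ]    = ≈-sym (-‿involutive _)

  ⟦⟧-homomorphism : ℤ.+-*-rawRing -Raw-AlmostCommutative⟶ fromCommutativeRing R
  ⟦⟧-homomorphism = record
    { ⟦_⟧ = ⟦_⟧ ; +-homo = ⟦⟧-+ ; *-homo = ⟦⟧-* ; -‿homo = ⟦⟧-neg
    ; 0-homo = ≈-refl ; 1-homo = ≈-refl }

  ⟦⟧-≟ : ∀ i j → Maybe (⟦ i ⟧ ≈ ⟦ j ⟧)
  ⟦⟧-≟ i j with i ℤ.≟ j
  ... | yes refl = just ≈-refl
  ... | no _       = nothing

  open import Algebra.Solver.Ring ℤ.+-*-rawRing (fromCommutativeRing R) ⟦⟧-homomorphism ⟦⟧-≟ public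
    using (solve; _:=_; _:+_; _:*_; _:-_; :-_; con)

module _ (ℝ : RealField) where
  open RealField ℝ

  commutativeRing : CommutativeRing _ _
  commutativeRing = record { isCommutativeRing = isCommutativeRing }

  open IntegerCoefficients commutativeRing using (solve; _:=_; _:+_; _:*_; _:-_; :-_; con)
  open CommutativeRing commutativeRing
    using (+-assoc; +-comm; *-comm; +-identityˡ; *-identityʳ;
           zeroˡ; zeroʳ; -‿inverseʳ; -‿inverseˡ; distribˡ)
  open import Algebra.Properties.Ring (CommutativeRing.ring commutativeRing)
    using (-0#≈0#; -‿involutive; -‿+-comm)
  open IsStrictTotalOrder isStrictTotalOrder using (compare; irrefl; _≟_) renaming (trans to <-trans)
  open ≡-Reasoning

  private
    variable
      k : ℕ

  sumF-cong : {f g : Fin k → R} → (∀ i → f i ≡ g i) → sumF f ≡ sumF g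
  sumF-cong {zero}  f≗g = refl
  sumF-cong {suc k} f≗g = cong₂ _+_ (f≗g zero) (sumF-cong (λ i → f≗g (suc i)))

  sumF-0 : sumF {k} (λ _ → 0#) ≡ 0#
  sumF-0 {zero}  = refl
  sumF-0 {suc k} = trans (cong (0# +_) (sumF-0 {k})) (+-identityˡ 0#)

  sumF-+ : (f g : Fin k → R) → sumF (λ i → f i + g i) ≡ sumF f + sumF g
  sumF-+ {zero}  f g = sym (+-identityˡ 0#)
  sumF-+ {suc k} f g = begin
    (f zero + g zero) + sumF (λ i → f (suc i) + g (suc i))
      ≡⟨ cong ((f zero + g zero) +_) (sumF-+ (λ i → f (suc i)) (λ i → g (suc i))) ⟩
    (f zero + g zero) + (sumF (λ i → f (suc i)) + sumF (λ i → g (suc i)))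
      ≡⟨ solve 4 (λ a b c d → (a :+ b) :+ (c :+ d) := (a :+ c) :+ (b :+ d)) refl _ _ _ _ ⟩
    (f zero + sumF (λ i → f (suc i))) + (g zero + sumF (λ i → g (suc i)))
      ∎

  sumF-*ˡ : ∀ c (f : Fin k → R) → sumF (λ i → c * f i) ≡ c * sumF f
  sumF-*ˡ {zero}  c f = sym (zeroʳ c)
  sumF-*ˡ {suc k} c f =
    trans (cong ((c * f zero) +_) (sumF-*ˡ c (λ i → f (suc i)))) (sym (distribˡ c (f zero) _))

  sumF-neg : (f : Fin k → R) → sumF (λ i → - f i) ≡ - sumF f
  sumF-neg {zero}  f = sym -0#≈0#
  sumF-neg {suc k} f =
    trans (cong ((- f zero) +_) (sumF-neg (λ i → f (suc i)))) (-‿+-comm (f zero) _)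

  sumF-- : (f g : Fin k → R) → sumF (λ i → f i - g i) ≡ sumF f - sumF g
  sumF-- f g = trans (sumF-+ f (λ i → - g i)) (cong (sumF f +_) (sumF-neg g))

  sumF-punchIn : (p : Fin (suc k)) (f : Fin (suc k) → R) →
                 sumF f ≡ f p + sumF (λ i → f (punchIn p i))
  sumF-punchIn         zero    f = refl
  sumF-punchIn {suc k} (suc p) f =
    trans (cong (f zero +_) (sumF-punchIn p (λ i → f (suc i))))
          (solve 3 (λ a b c → a :+ (b :+ c) := b :+ (a :+ c)) refl (f zero) (f (suc p)) _)

  sumF-fromℕ : (f : Fin (suc k) → R) → sumF f ≡ sumF (λ i → f (inject₁ i)) + f (fromℕ k)
  sumF-fromℕ {zero}  f = +-comm (f zero) 0#
  sumF-fromℕ {suc k} f =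
    trans (cong (f zero +_) (sumF-fromℕ (λ i → f (suc i)))) (sym (+-assoc _ _ _))

  sumF-agree-at : ∀ (p : Fin (suc k)) {f g : Fin (suc k) → R} → sumF f ≡ sumF g →
                  (∀ i → f (punchIn p i) ≡ g (punchIn p i)) → f p ≡ g p
  sumF-agree-at p {f} {g} Σf≡Σg f≗g = begin
    f p                        ≡⟨ solve 2 (λ x s → x := (x :+ s) :- s) refl (f p) rest ⟩
    (f p + rest) - rest        ≡⟨ cong (_- rest) (trans (sym (sumF-punchIn p f)) Σf≡Σg) ⟩
    sumF g - rest              ≡⟨ cong₂ _-_ (sumF-punchIn p g) (sumF-cong f≗g) ⟩
    (g p + rest′) - rest′      ≡⟨ solve 2 (λ x s → (x :+ s) :- s := x) refl (g p) rest′ ⟩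
    g p                        ∎
    where
      rest  = sumF (λ i → f (punchIn p i))
      rest′ = sumF (λ i → g (punchIn p i))

  punchIn-cases : ∀ {p} {P : Fin (suc k) → Set p} j → P j → (∀ l → P (punchIn j l)) → ∀ i → P i
  punchIn-cases {P = P} j Pj P-punchIn i with j Fin.≟ i
  ... | yes refl = Pj
  ... | no j≢i   = subst P (punchIn-punchOut j≢i) (P-punchIn (Fin.punchOut j≢i))


  next-inject₁ : (i : Fin k) → next (inject₁ i) ≡ suc i
  next-inject₁ {k} i with suc (toℕ (inject₁ i)) ℕ.<? suc k
  ... | yes p = toℕ-injective (trans (Finₚ.toℕ-fromℕ< p) (cong suc (Finₚ.toℕ-inject₁ i)))
  ... | no ¬p = ⊥-elim (¬p (ℕ.s≤s (subst (ℕ._< k) (sym (Finₚ.toℕ-inject₁ i)) (Finₚ.toℕ<n i))))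

  next-fromℕ : ∀ k → next (fromℕ k) ≡ zero
  next-fromℕ k with suc (toℕ (fromℕ k)) ℕ.<? suc k
  ... | yes p = ⊥-elim (ℕₚ.<-irrefl refl (subst (λ z → suc z ℕ.< suc k) (Finₚ.toℕ-fromℕ k) p))
  ... | no _  = refl

  fromℕ-or-inject₁ : (i : Fin (suc k)) → i ≡ fromℕ k ⊎ ∃ λ j → i ≡ inject₁ j
  fromℕ-or-inject₁ {zero}  zero    = inj₁ refl
  fromℕ-or-inject₁ {suc k} zero    = inj₂ (zero , refl)
  fromℕ-or-inject₁ {suc k} (suc i) with fromℕ-or-inject₁ i
  ... | inj₁ i≡fromℕ     = inj₁ (cong suc i≡fromℕ)
  ... | inj₂ (j , i≡j)   = inj₂ (suc j , cong suc i≡j)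

  sumF-next : (f : Fin (suc k) → R) → sumF (λ i → f (next i)) ≡ sumF f
  sumF-next {k} f = begin
    sumF (λ i → f (next i))                                ≡⟨ sumF-fromℕ (λ i → f (next i)) ⟩
    sumF (λ i → f (next (inject₁ i))) + f (next (fromℕ k))
      ≡⟨ cong₂ _+_ (sumF-cong (λ i → cong f (next-inject₁ i))) (cong f (next-fromℕ k)) ⟩
    sumF (λ i → f (suc i)) + f zero                        ≡⟨ +-comm _ _ ⟩
    sumF f                                                 ∎

  sumF-cyclic-differences : (f : Fin (suc k) → R) → sumF (λ i → f i - f (next i)) ≡ 0#
  sumF-cyclic-differences f = begin
    sumF (λ i → f i - f (next i))          ≡⟨ sumF-- f (λ i → f (next i)) ⟩
    sumF f - sumF (λ i → f (next i))       ≡⟨ cong (λ s → sumF f - s) (sumF-next f) ⟩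
    sumF f - sumF f                        ≡⟨ -‿inverseʳ _ ⟩
    0#                                     ∎

  prefixSum : (Fin (suc k) → R) → Fin (suc k) → R
  prefixSum         γ zero    = 0#
  prefixSum {suc k} γ (suc i) = γ zero + prefixSum (λ j → γ (suc j)) i

  prefixSum-suc : (γ : Fin (suc k) → R) (i : Fin k) →
                  prefixSum γ (suc i) ≡ prefixSum γ (inject₁ i) + γ (inject₁ i)
  prefixSum-suc {suc k} γ zero    = +-comm (γ zero) 0#
  prefixSum-suc {suc k} γ (suc i) =
    trans (cong (γ zero +_) (prefixSum-suc (λ j → γ (suc j)) i)) (sym (+-assoc _ _ _))

  prefixSum-fromℕ : (γ : Fin (suc k) → R) → prefixSum γ (fromℕ k) + γ (fromℕ k) ≡ sumF γ
  prefixSum-fromℕ {zero}  γ = +-comm 0# (γ zero)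
  prefixSum-fromℕ {suc k} γ =
    trans (+-assoc _ _ _) (cong (γ zero +_) (prefixSum-fromℕ (λ j → γ (suc j))))

  -- On the last index the step wraps around to prefixSum γ zero = 0, which is where Σ γ = 0 enters.
  prefixSum-next : (γ : Fin (suc k) → R) → sumF γ ≡ 0# →
                   ∀ i → prefixSum γ (next i) - prefixSum γ i ≡ γ i
  prefixSum-next {k} γ Σγ≡0 i with fromℕ-or-inject₁ i
  ... | inj₁ refl = begin
    prefixSum γ (next (fromℕ k)) - P     ≡⟨ cong (λ j → prefixSum γ j - P) (next-fromℕ k) ⟩
    0# - P                               ≡⟨ solve 2 (λ p g → con ℤ.0ℤ :- p := g :- (p :+ g)) refl P g ⟩
    g - (P + g)                          ≡⟨ cong (λ s → g - s) (trans (prefixSum-fromℕ γ) Σγ≡0) ⟩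
    g - 0#                               ≡⟨ solve 1 (λ x → x :- con ℤ.0ℤ := x) refl g ⟩
    g                                    ∎
    where
      P = prefixSum γ (fromℕ k)
      g = γ (fromℕ k)
  ... | inj₂ (j , refl) = begin
    prefixSum γ (next (inject₁ j)) - P   ≡⟨ cong (λ j′ → prefixSum γ j′ - P) (next-inject₁ j) ⟩
    prefixSum γ (suc j) - P              ≡⟨ cong (_- P) (prefixSum-suc γ j) ⟩
    (P + g) - P                          ≡⟨ solve 2 (λ p g → (p :+ g) :- p := g) refl P g ⟩
    g                                    ∎
    where
      P = prefixSum γ (inject₁ j)
      g = γ (inject₁ j)

  -- Linear systems with linearly independent coefficient vectors

  dot : ∀ {d} → Pt d → Pt d → R
  dot x w = sumF (λ t → x t * w t)

  ∣_∣² : ∀ {d} → Pt d → R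
  ∣ x ∣² = dot x x

  combination : ∀ {d} → (Fin k → R) → (Fin k → Pt d) → Pt d
  combination c w t = sumF (λ l → c l * w l t)

  Solvable : ∀ {k d} → (Fin k → Pt d) → Set
  Solvable {k} {d} w = ∀ (c : Fin k → R) → ∃ λ (x : Pt d) → ∀ l → dot x (w l) ≡ c l

  combination-insertAt : ∀ {d} (a : Fin k → R) p β (w : Fin (suc k) → Pt d) t →
    combination (insertAt a p β) w t ≡ β * w p t + combination a (λ l → w (punchIn p l)) t
  combination-insertAt a p β w t = trans (sumF-punchIn p (λ i → insertAt a p β i * w i t))
    (cong₂ _+_ (cong (_* w p t) (insertAt-lookup a p β))
               (sumF-cong (λ l → cong (_* w (punchIn p l) t) (insertAt-punchIn a p β l))))

  ¬LinIndep-dim0 : (w : Fin (suc k) → Pt 0) → ¬ LinIndep w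
  ¬LinIndep-dim0 w li = 0≢1 (sym (li (λ _ → 1#) (λ ()) zero))

  LinIndep-tail : ∀ {k d} (w : Fin k → Pt (suc d)) → (∀ l → Vec.head (w l) ≡ 0#) →
                  LinIndep w → LinIndep (λ l → Vec.tail (w l))
  LinIndep-tail {k} w head≡0 li c Σ≡0 = li c λ
    { zero    → trans (sumF-cong (λ l → trans (cong (c l *_) (head≡0 l)) (zeroʳ (c l)))) (sumF-0 {k})
    ; (suc t) → Σ≡0 t }

  -- Gaussian elimination of the first coordinate with pivot row p.
  module Pivot {k d} (w : Fin (suc k) → Pt (suc d)) (p : Fin (suc k))
               (pivot≢0 : Vec.head (w p) ≢ 0#) where

    α₀ : R
    α₀ = Vec.head (w p)

    u₀ : Pt d
    u₀ = Vec.tail (w p)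

    α : Fin k → R
    α l = Vec.head (w (punchIn p l))

    u : Fin k → Pt d
    u l = Vec.tail (w (punchIn p l))

    ι : R
    ι = proj₁ (inverse α₀ pivot≢0)

    α₀*ι : α₀ * ι ≡ 1#
    α₀*ι = proj₂ (inverse α₀ pivot≢0)

    r : Fin k → R
    r l = α l * ι

    eliminated : Fin k → Pt d
    eliminated l t = u l t - (r l * u₀ t)

    combination-eliminated : ∀ (a : Fin k → R) t →
      combination a eliminated t ≡ combination a u t + (- sumF (λ l → a l * r l)) * u₀ t
    combination-eliminated a t = begin
      sumF (λ l → a l * eliminated l t)
        ≡⟨ sumF-cong (λ l → solve 4 (λ x y ρ z → x :* (y :- ρ :* z) := x :* y :- (x :* ρ) :* z)
                                    refl (a l) (u l t) (r l) (u₀ t)) ⟩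
      sumF (λ l → (a l * u l t) - ((a l * r l) * u₀ t))
        ≡⟨ sumF-- (λ l → a l * u l t) (λ l → (a l * r l) * u₀ t) ⟩
      combination a u t - sumF (λ l → (a l * r l) * u₀ t)
        ≡⟨ cong (λ s → combination a u t - s)
                (trans (sumF-cong (λ l → *-comm (a l * r l) (u₀ t)))
                       (trans (sumF-*ˡ (u₀ t) (λ l → a l * r l)) (*-comm (u₀ t) _))) ⟩
      combination a u t - (sumF (λ l → a l * r l) * u₀ t)
        ≡⟨ solve 3 (λ c s z → c :- s :* z := c :+ (:- s) :* z) refl (combination a u t) _ (u₀ t) ⟩
      combination a u t + (- sumF (λ l → a l * r l)) * u₀ t
        ∎

    -- A dependency a among the eliminated rows lifts to one among the rows of w,
    -- with coefficient -Σ aₗ rₗ on the pivot row.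
    LinIndep-eliminated : LinIndep w → LinIndep eliminated
    LinIndep-eliminated li a Σ≡0 l =
      trans (sym (insertAt-punchIn a p β l)) (li (insertAt a p β) lifted (punchIn p l))
      where
        β = - sumF (λ l → a l * r l)
        S = sumF (λ l → a l * α l)
        lifted : ∀ t → combination (insertAt a p β) w t ≡ 0#
        lifted zero = begin
          combination (insertAt a p β) w zero    ≡⟨ combination-insertAt a p β w zero ⟩
          β * α₀ + S
            ≡⟨ cong (λ s → (- s) * α₀ + S)
                    (trans (sumF-cong (λ l → solve 3 (λ x y i → x :* (y :* i) := i :* (x :* y))
                                                     refl (a l) (α l) ι))
                           (sumF-*ˡ ι (λ l → a l * α l))) ⟩
          (- (ι * S)) * α₀ + S
            ≡⟨ solve 3 (λ i s h → (:- (i :* s)) :* h :+ s := s :* (con ℤ.1ℤ :- h :* i)) refl ι S α₀ ⟩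
          S * (1# - (α₀ * ι))                    ≡⟨ cong (λ z → S * (1# - z)) α₀*ι ⟩
          S * (1# - 1#)
            ≡⟨ solve 1 (λ s → s :* (con ℤ.1ℤ :- con ℤ.1ℤ) := con ℤ.0ℤ) refl S ⟩
          0#                                     ∎
        lifted (suc t) = begin
          combination (insertAt a p β) w (suc t)  ≡⟨ combination-insertAt a p β w (suc t) ⟩
          β * u₀ t + combination a u t            ≡⟨ +-comm _ _ ⟩
          combination a u t + β * u₀ t            ≡⟨ sym (combination-eliminated a t) ⟩
          combination a eliminated t              ≡⟨ Σ≡0 t ⟩
          0#                                      ∎

    dot-eliminated : ∀ x l → dot x (eliminated l) ≡ dot x (u l) - (r l * dot x u₀)
    dot-eliminated x l = begin
      sumF (λ t → x t * eliminated l t)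
        ≡⟨ sumF-cong (λ t → solve 4 (λ x y ρ z → x :* (y :- ρ :* z) := x :* y :- ρ :* (x :* z))
                                    refl (x t) (u l t) (r l) (u₀ t)) ⟩
      sumF (λ t → (x t * u l t) - (r l * (x t * u₀ t)))
        ≡⟨ sumF-- (λ t → x t * u l t) (λ t → r l * (x t * u₀ t)) ⟩
      dot x (u l) - sumF (λ t → r l * (x t * u₀ t))
        ≡⟨ cong (λ s → dot x (u l) - s) (sumF-*ˡ (r l) (λ t → x t * u₀ t)) ⟩
      dot x (u l) - (r l * dot x u₀)
        ∎

    -- Solve the eliminated system for the last d coordinates, then the pivot row for the first.
    Solvable-eliminated : Solvable eliminated → Solvable w
    Solvable-eliminated solvable c = x , punchIn-cases p dot-x-pivot dot-x-punchIn
      where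
        solution = solvable (λ l → c (punchIn p l) - (r l * c p))
        y = proj₁ solution
        D = dot y u₀
        x = ((c p - D) * ι) ∷ y
        dot-x-pivot : dot x (w p) ≡ c p
        dot-x-pivot = begin
          (c p - D) * ι * α₀ + D
            ≡⟨ solve 4 (λ c d i h → (c :- d) :* i :* h :+ d := (c :- d) :* (h :* i) :+ d)
                       refl (c p) D ι α₀ ⟩
          (c p - D) * (α₀ * ι) + D            ≡⟨ cong (λ z → (c p - D) * z + D) α₀*ι ⟩
          (c p - D) * 1# + D
            ≡⟨ solve 2 (λ c d → (c :- d) :* con ℤ.1ℤ :+ d := c) refl (c p) D ⟩
          c p                                 ∎
        dot-x-punchIn : ∀ l → dot x (w (punchIn p l)) ≡ c (punchIn p l)
        dot-x-punchIn l = begin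
          (c p - D) * ι * α l + dot y (u l)
            ≡⟨ solve 5 (λ c d i h e → (c :- d) :* i :* h :+ e := (e :- (h :* i) :* d) :+ (h :* i) :* c)
                       refl (c p) D ι (α l) (dot y (u l)) ⟩
          (dot y (u l) - (r l * D)) + r l * c p
            ≡⟨ cong (_+ r l * c p) (trans (sym (dot-eliminated y l)) (proj₂ solution l)) ⟩
          (c (punchIn p l) - (r l * c p)) + r l * c p
            ≡⟨ solve 2 (λ a b → (a :- b) :+ b := a) refl (c (punchIn p l)) (r l * c p) ⟩
          c (punchIn p l)
            ∎

  LinIndep⇒Solvable : ∀ {d} (w : Fin k → Pt d) → LinIndep w → Solvable w
  LinIndep⇒Solvable {zero}  {d}     w li c = (λ _ → 0#) , λ ()
  LinIndep⇒Solvable {suc k} {zero}  w li   = ⊥-elim (¬LinIndep-dim0 w li)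
  LinIndep⇒Solvable {suc k} {suc d} w li with all? (λ l → Vec.head (w l) ≟ 0#)
  ... | yes head≡0 = λ c →
    let (y , dot-y) = LinIndep⇒Solvable (λ l → Vec.tail (w l)) (LinIndep-tail w head≡0 li) c
    in (0# ∷ y) , λ l →
         trans (cong (_+ dot y (Vec.tail (w l))) (zeroˡ _)) (trans (+-identityˡ _) (dot-y l))
  ... | no ¬head≡0 =
    let (p , pivot≢0) = ¬∀⟶∃¬ _ _ (λ l → Vec.head (w l) ≟ 0#) ¬head≡0
        open Pivot w p pivot≢0
    in Solvable-eliminated (LinIndep⇒Solvable eliminated (LinIndep-eliminated li))

  AffIndep⇒LinIndep : ∀ {d} (P : Fin (suc k) → Pt d) → AffIndep P →
                      LinIndep (λ l → P (suc l) −ᵥ P zero)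
  AffIndep⇒LinIndep P aff c Σ≡0 l = aff ((- sumF c) ∷ c) (-‿inverseˡ (sumF c)) affine (suc l)
    where
      affine : ∀ t → sumF (λ i → ((- sumF c) ∷ c) i * P i t) ≡ 0#
      affine t = begin
        (- sumF c) * P zero t + combination c (λ l → P (suc l)) t
          ≡⟨ solve 3 (λ s b u → (:- s) :* b :+ u := u :- b :* s) refl (sumF c) (P zero t) _ ⟩
        combination c (λ l → P (suc l)) t - (P zero t * sumF c)
          ≡⟨ cong (λ s → combination c (λ l → P (suc l)) t - s)
                  (trans (sym (sumF-*ˡ (P zero t) c)) (sumF-cong (λ l → *-comm (P zero t) (c l)))) ⟩
        combination c (λ l → P (suc l)) t - sumF (λ l → c l * P zero t)
          ≡⟨ sym (sumF-- (λ l → c l * P (suc l) t) (λ l → c l * P zero t)) ⟩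
        sumF (λ l → (c l * P (suc l) t) - (c l * P zero t))
          ≡⟨ sumF-cong (λ l → solve 3 (λ c u b → c :* u :- c :* b := c :* (u :- b))
                                      refl (c l) (P (suc l) t) (P zero t)) ⟩
        combination c (λ l → P (suc l) −ᵥ P zero) t
          ≡⟨ Σ≡0 t ⟩
        0#
          ∎

  0<1 : 0# < 1#
  0<1 with compare 0# 1#
  ... | tri< 0<1 _ _ = 0<1
  ... | tri≈ _ 0≡1 _ = ⊥-elim (0≢1 0≡1)
  ... | tri> _ _ 1<0 = ⊥-elim (irrefl refl (<-trans 0<1′ 1<0))
    where
      0<-1 : 0# < (- 1#)
      0<-1 = subst₂ _<_ (-‿inverseʳ 1#) (+-identityˡ (- 1#)) (+-mono-< (- 1#) 1<0)
      0<1′ : 0# < 1#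
      0<1′ = subst (0# <_) (solve 0 (:- con ℤ.1ℤ :* :- con ℤ.1ℤ := con ℤ.1ℤ) refl) (*-pos 0<-1 0<-1)

  2≢0 : 1# + 1# ≢ 0#
  2≢0 2≡0 = irrefl refl (subst (0# <_) 2≡0 0<2)
    where
      0<2 : 0# < (1# + 1#)
      0<2 = <-trans 0<1 (subst (_< (1# + 1#)) (+-identityˡ 1#) (+-mono-< 1# 0<1))

  ½ : R
  ½ = proj₁ (inverse (1# + 1#) 2≢0)

  halve : ∀ {d} → Pt d → Pt d
  halve y t = y t * ½

  halve-+ : ∀ x → x * ½ + x * ½ ≡ x
  halve-+ x = begin
    x * ½ + x * ½
      ≡⟨ solve 2 (λ x h → x :* h :+ x :* h := x :* ((con ℤ.1ℤ :+ con ℤ.1ℤ) :* h)) refl x ½ ⟩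
    x * ((1# + 1#) * ½)          ≡⟨ cong (x *_) (proj₂ (inverse (1# + 1#) 2≢0)) ⟩
    x * 1#                       ≡⟨ *-identityʳ x ⟩
    x                            ∎

  dist²-difference : ∀ {d} (x a b : Pt d) →
    dist² x a - dist² x b ≡ dot (λ t → x t + x t) (b −ᵥ a) + (∣ a ∣² - ∣ b ∣²)
  dist²-difference x a b = begin
    dist² x a - dist² x b
      ≡⟨ sym (sumF-- (λ t → (x t - a t) * (x t - a t)) (λ t → (x t - b t) * (x t - b t))) ⟩
    sumF (λ t → ((x t - a t) * (x t - a t)) - ((x t - b t) * (x t - b t)))
      ≡⟨ sumF-cong (λ t → solve 3 (λ x a b → (x :- a) :* (x :- a) :- (x :- b) :* (x :- b)
                                            := (x :+ x) :* (b :- a) :+ (a :* a :- b :* b))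
                                  refl (x t) (a t) (b t)) ⟩
    sumF (λ t → (x t + x t) * (b t - a t) + ((a t * a t) - (b t * b t)))
      ≡⟨ sumF-+ (λ t → (x t + x t) * (b t - a t)) (λ t → (a t * a t) - (b t * b t)) ⟩
    dot (λ t → x t + x t) (b −ᵥ a) + sumF (λ t → (a t * a t) - (b t * b t))
      ≡⟨ cong (dot (λ t → x t + x t) (b −ᵥ a) +_) (sumF-- (λ t → a t * a t) (λ t → b t * b t)) ⟩
    dot (λ t → x t + x t) (b −ᵥ a) + (∣ a ∣² - ∣ b ∣²)
      ∎

  dist²-difference-halve : ∀ {d} (y a b : Pt d) →
    dist² (halve y) a - dist² (halve y) b ≡ dot y (b −ᵥ a) + (∣ a ∣² - ∣ b ∣²)
  dist²-difference-halve y a b = trans (dist²-difference (halve y) a b)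
    (cong (_+ (∣ a ∣² - ∣ b ∣²)) (sumF-cong (λ t → cong (_* (b t - a t)) (halve-+ (y t)))))

  -- Circles in a gain graph

  module _ {d n m} (Γ : Graph n m) (g : Fin m → R) (q : Fin n → Pt d) where
    open GainGraph ℝ Γ

    DartEquation : Pt d → Dart m → Set
    DartEquation x δ = dist² x (q (tail Γ δ)) - dist² x (q (head Γ δ)) ≡ dartGain g δ

    private
      flip-difference : ∀ {a b c} → a - b ≡ c → b - a ≡ - c
      flip-difference {a} {b} {c} eq = trans (solve 2 (λ a b → b :- a := :- (a :- b)) refl a b) (cong -_ eq)

    DartEquation⇒∈h : ∀ x δ → DartEquation x δ → x ∈h[ q , g , proj₁ δ ]
    DartEquation⇒∈h x (e , true)  eq = eq
    DartEquation⇒∈h x (e , false) eq = trans (flip-difference eq) (-‿involutive (g e))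

    ∈h⇒DartEquation : ∀ x δ → x ∈h[ q , g , proj₁ δ ] → DartEquation x δ
    ∈h⇒DartEquation x (e , true)  eq = eq
    ∈h⇒DartEquation x (e , false) eq = flip-difference eq

    module _ (C : Circle Γ) where
      open Circle C

      tailPt headPt : Fin (suc len) → Pt d
      tailPt i = q (tail Γ (darts i))
      headPt i = q (head Γ (darts i))

      gain : Fin (suc len) → R
      gain i = dartGain g (darts i)

      dartDifference : Pt d → Fin (suc len) → R
      dartDifference x i = dist² x (tailPt i) - dist² x (headPt i)

      headPt≡tailPt-next : ∀ i → headPt i ≡ tailPt (next i)
      headPt≡tailPt-next i = cong q (closed i)

      DartEquations⇒central : ∀ x → (∀ i → DartEquation x (darts i)) → Central q g C
      DartEquations⇒central x eqs = x , λ i → DartEquation⇒∈h x (darts i) (eqs i)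

      sumF-dartDifference : ∀ x → sumF (dartDifference x) ≡ 0#
      sumF-dartDifference x = begin
        sumF (dartDifference x)
          ≡⟨ sumF-cong (λ i → cong (λ z → dist² x (tailPt i) - dist² x z) (headPt≡tailPt-next i)) ⟩
        sumF (λ i → dist² x (tailPt i) - dist² x (tailPt (next i)))
          ≡⟨ sumF-cyclic-differences (λ i → dist² x (tailPt i)) ⟩
        0#
          ∎

      central⇒balanced : Central q g C → Balanced g C
      central⇒balanced (x , x∈h) =
        trans (sumF-cong (λ i → sym (∈h⇒DartEquation x (darts i) (x∈h i)))) (sumF-dartDifference x)

      all-but-one⇒central : Balanced g C → ∀ x j →
        (∀ l → DartEquation x (darts (punchIn j l))) → Central q g C
      all-but-one⇒central balanced x j eqs =
        DartEquations⇒central x (punchIn-cases j eq-j eqs)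
        where
          eq-j : DartEquation x (darts j)
          eq-j = sumF-agree-at j {f = dartDifference x} {g = gain}
                   (trans (sumF-dartDifference x) (sym balanced)) eqs

      prefixSums⇒central : Balanced g C → ∀ x →
        (∀ i → dist² x (tailPt zero) - dist² x (tailPt i) ≡ prefixSum gain i) → Central q g C
      prefixSums⇒central balanced x prefix = DartEquations⇒central x λ i → begin
        dist² x (tailPt i) - dist² x (headPt i)
          ≡⟨ cong (λ z → G i - dist² x z) (headPt≡tailPt-next i) ⟩
        G i - G (next i)
          ≡⟨ solve 3 (λ a b z → a :- b := (z :- b) :- (z :- a)) refl (G i) (G (next i)) (G zero) ⟩
        (G zero - G (next i)) - (G zero - G i)
          ≡⟨ cong₂ _-_ (prefix (next i)) (prefix i) ⟩
        prefixSum gain (next i) - prefixSum gain i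
          ≡⟨ prefixSum-next gain balanced i ⟩
        gain i
          ∎
        where
          G : Fin (suc len) → R
          G i = dist² x (tailPt i)

      LinIndep⇒central : Balanced g C → ∀ j →
        LinIndep (λ l → headPt (punchIn j l) −ᵥ tailPt (punchIn j l)) → Central q g C
      LinIndep⇒central balanced j li =
        all-but-one⇒central balanced (halve y) j λ l → begin
          dist² (halve y) (a l) - dist² (halve y) (b l)  ≡⟨ dist²-difference-halve y (a l) (b l) ⟩
          dot y (b l −ᵥ a l) + K l                       ≡⟨ cong (_+ K l) (dot-y l) ⟩
          (gain (punchIn j l) - K l) + K l
            ≡⟨ solve 2 (λ γ κ → (γ :- κ) :+ κ := γ) refl (gain (punchIn j l)) (K l) ⟩
          gain (punchIn j l)                             ∎
        where
          a b : Fin len → Pt d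
          a l = tailPt (punchIn j l)
          b l = headPt (punchIn j l)
          K : Fin len → R
          K l = ∣ a l ∣² - ∣ b l ∣²
          solution = LinIndep⇒Solvable (λ l → b l −ᵥ a l) li (λ l → gain (punchIn j l) - K l)
          y = proj₁ solution
          dot-y = proj₂ solution

      AffIndep⇒central : Balanced g C → AffIndep tailPt → Central q g C
      AffIndep⇒central balanced aff = prefixSums⇒central balanced (halve y) prefix
        where
          K : Fin len → R
          K l = ∣ tailPt zero ∣² - ∣ tailPt (suc l) ∣²
          solution = LinIndep⇒Solvable _ (AffIndep⇒LinIndep tailPt aff)
                                         (λ l → prefixSum gain (suc l) - K l)
          y = proj₁ solution
          prefix : ∀ i → dist² (halve y) (tailPt zero) - dist² (halve y) (tailPt i) ≡ prefixSum gain i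
          prefix zero    = -‿inverseʳ _
          prefix (suc l) = begin
            dist² (halve y) (tailPt zero) - dist² (halve y) (tailPt (suc l))
              ≡⟨ dist²-difference-halve y (tailPt zero) (tailPt (suc l)) ⟩
            dot y (tailPt (suc l) −ᵥ tailPt zero) + K l
              ≡⟨ cong (_+ K l) (proj₂ solution l) ⟩
            (prefixSum gain (suc l) - K l) + K l
              ≡⟨ solve 2 (λ γ κ → (γ :- κ) :+ κ := γ) refl _ (K l) ⟩
            prefixSum gain (suc l)
              ∎

mainTheorem2 : (ℝ : RealField) → (d n m : ℕ) → (Γ : Graph n m)
    → (g : Fin m → RealField.R ℝ)
    → (q : Fin n → RealField.Pt ℝ d) → Injective _≡_ _≡_ q
    → (C : Circle Γ)
    → (GainGraph.Central ℝ Γ q g C → GainGraph.Balanced ℝ Γ g C)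
    × (GainGraph.Balanced ℝ Γ g C
        → (∃ λ (j : Fin (suc (Circle.len C)))
             → RealField.LinIndep ℝ
                 (λ l → RealField._−ᵥ_ ℝ
                   (q (head Γ (Circle.darts C (punchIn j l))))
                   (q (tail Γ (Circle.darts C (punchIn j l))))))
        → GainGraph.Central ℝ Γ q g C)
    × (GainGraph.Balanced ℝ Γ g C
        → suc (Circle.len C) ≤ suc d
        → RealField.AffinePosition ℝ (λ i → q (tail Γ (Circle.darts C i)))
        → GainGraph.Central ℝ Γ q g C)
mainTheorem2 ℝ d n m Γ g q _ C =
    central⇒balanced ℝ Γ g q C
  , (λ balanced (j , li) → LinIndep⇒central ℝ Γ g q C balanced j li)
  , (λ balanced len≤d affine →
       AffIndep⇒central ℝ Γ g q C balanced (affine _ (λ i → i) (λ eq → eq) len≤d))
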